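{- Let $c\ge1$, $d\ge 2$ and $a_1,\dots,a_c\ge 0$ be integers. Every $d$-branch tree whose vertices are coloured with colours from $[c]=\{1,\dots,c\}$ and whose effective height is at least $\sum_{i=1}^c a_i$ contains, for some $i\in[c]$, an essentially $i$-monochromatic $d$-branch subtree of effective height at least $a_i$.
   Context: Let $T$ be a rooted tree with root $r$. A branch vertex is a vertex with at least two children. The effective vertices of $T$ are its leaves and its branch vertices. The effective height of $T$ is the minimum, over all leaves of $T$, of the number of branch vertices on the path from $r$ to that leaf. $T$ is essentially $i$-monochromatic if all its effective vertices have colour $i$. For $d\ge2$, a $d$-branch tree is a rooted tree in which every branch vertex has at least $d$ children. A subtree of $T$ is a subgraph that is a tree, rooted at its vertex closest to $r$ (children being taken within the subtree). -}

module Defs where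

open import Data.Nat using (ℕ; zero; suc; _≤_; _⊓_)
open import Data.Fin using (Fin)
open import Data.List using (List; []; _∷_; length)
open import Data.List.Membership.Propositional using (_∈_)
open import Data.Product using (_×_)
open import Data.Unit using (⊤)
open import Relation.Binary.PropositionalEquality using (_≡_)

-- Finite rooted trees whose vertices are coloured by Fin c.
-- A vertex is `node x ts`: colour x, children ts (the list order is irrelevant).
data Tree (c : ℕ) : Set where
  node : Fin c → List (Tree c) → Tree c

module _ {c : ℕ} where

  -- Effective height: minimum over leaves of the number of branch vertices
  -- (vertices with ≥ 2 children) on the root-to-leaf path.
  mutual
    effHeight : Tree c → ℕ
    effHeight (node x [])            = 0
    effHeight (node x (t ∷ []))      = effHeight t
    effHeight (node x (t ∷ u ∷ ts))  = suc (minEH t (u ∷ ts))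

    minEH : Tree c → List (Tree c) → ℕ
    minEH t []        = effHeight t
    minEH t (u ∷ ts)  = effHeight t ⊓ minEH u ts

  mutual
    IsDBranch : ℕ → Tree c → Set
    IsDBranch d (node x ts) = (2 ≤ length ts → d ≤ length ts) × AllDBranch d ts

    AllDBranch : ℕ → List (Tree c) → Set
    AllDBranch d []       = ⊤
    AllDBranch d (t ∷ ts) = IsDBranch d t × AllDBranch d ts

  -- Essentially i-monochromatic: every effective vertex (leaf or branch
  -- vertex) has colour i.
  mutual
    EssMono : Fin c → Tree c → Set
    EssMono i (node x [])           = x ≡ i
    EssMono i (node x (t ∷ []))     = EssMono i t
    EssMono i (node x (t ∷ u ∷ ts)) = x ≡ i × AllEssMono i (t ∷ u ∷ ts)

    AllEssMono : Fin c → List (Tree c) → Set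
    AllEssMono i []       = ⊤
    AllEssMono i (t ∷ ts) = EssMono i t × AllEssMono i ts

  -- Rooted embedding  s ≼ t : s is (a copy of) a subtree of t containing the
  -- root of t, with colours inherited.  Each vertex of s maps to a vertex of t
  -- with the same colour, and distinct children of a vertex of s map to
  -- distinct children of the image (order-preserving sublist; since children
  -- order is irrelevant this captures every subgraph).
  mutual
    data _≼_ : Tree c → Tree c → Set where
      node : ∀ {x ss ts} → ss ⊑ ts → node x ss ≼ node x ts

    data _⊑_ : List (Tree c) → List (Tree c) → Set where
      []   : [] ⊑ []
      skip : ∀ {ss t ts} → ss ⊑ ts → ss ⊑ (t ∷ ts)
      keep : ∀ {s ss t ts} → s ≼ t → ss ⊑ ts → (s ∷ ss) ⊑ (t ∷ ts)

  -- Subtree: a subgraph that is a tree, rooted at its vertex closest to the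
  -- root; i.e. a rooted embedding into the subtree below some vertex of t.
  data _⊆ᵀ_ : Tree c → Tree c → Set where
    here  : ∀ {s t} → s ≼ t → s ⊆ᵀ t
    there : ∀ {s x t ts} → t ∈ ts → s ⊆ᵀ t → s ⊆ᵀ node x ts

module Submission where

-- For a budget vector v = (v₁,…,v_c) and a d-branch tree T with
-- v₁+…+v_c ≤ effHeight T we find a colour i and an essentially
-- i-monochromatic d-branch tree of effective height ≥ vᵢ embedded in T at its
-- root ( witness ).  A leaf of colour x works for x, since
-- vₓ ≤ Σ v ≤ 0; a vertex with one child inherits its child's witness.  At a
-- branch vertex of colour x: if vₓ = 0 the root alone works; otherwise lower
-- vₓ by one, so that every child has a witness for the lowered budget.  A
-- child witness of colour i ≠ x is valid for v and is hung below the root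
-- ( descend ); if all child witnesses have colour x, grafting them below the
-- root ( graft ) yields an x-monochromatic tree of height ≥ vₓ.

open import Defs
open import Data.Nat using (ℕ; _≤_; _+_)
open import Data.Fin using (Fin)
open import Data.Vec using (sum; tabulate)
open import Data.Product using (Σ; _×_)

open import Data.Nat using (zero; suc; pred; z≤n; s≤s; s≤s⁻¹)
open import Data.Nat.Properties
  using (≤-trans; ≤-reflexive; m≤m+n; m≤n+m; +-suc; m⊓n≤m; m⊓n≤n; ⊓-glb)
open import Data.Fin using (zero; suc)
open import Data.Fin.Properties using (_≟_)
open import Data.Vec using (Vec; []; _∷_; lookup; _[_]%=_)
open import Data.Vec.Properties using (lookup∘updateAt; lookup∘updateAt′; lookup∘tabulate)
open import Data.List using (List; []; _∷_; length)
open import Data.List.Membership.Propositional using (_∈_; find)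
open import Data.List.Relation.Unary.All using (All; []; _∷_)
import Data.List.Relation.Unary.All as All
open import Data.List.Relation.Unary.Any using (Any; here; there)
open import Data.Product using (_,_)
open import Data.Sum using (_⊎_; inj₁; inj₂)
import Data.Sum as Sum
open import Data.Unit using (tt)
open import Relation.Nullary using (yes; no)
open import Relation.Binary.PropositionalEquality
  using (_≡_; refl; sym; trans; cong; subst; module ≡-Reasoning)

lower : ∀ {n} → Vec ℕ n → Fin n → Vec ℕ n
lower v x = v [ x ]%= pred

lookup≤sum : ∀ {n} (v : Vec ℕ n) (i : Fin n) → lookup v i ≤ sum v
lookup≤sum (y ∷ v) zero    = m≤m+n y (sum v)
lookup≤sum (y ∷ v) (suc i) = ≤-trans (lookup≤sum v i) (m≤n+m (sum v) y)

sum-lower : ∀ {n} (v : Vec ℕ n) (x : Fin n) {k : ℕ} →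
            lookup v x ≡ suc k → sum v ≡ suc (sum (lower v x))
sum-lower (y ∷ v) zero    refl = refl
sum-lower (y ∷ v) (suc x) eq   = begin
  y + sum v                    ≡⟨ cong (y +_) (sum-lower v x eq) ⟩
  y + suc (sum (lower v x))    ≡⟨ +-suc y (sum (lower v x)) ⟩
  suc (y + sum (lower v x))    ∎
  where open ≡-Reasoning

anyOrAll : ∀ {a p q} {A : Set a} {P : A → Set p} {Q : A → Set q} {xs : List A} →
           All (λ x → P x ⊎ Q x) xs → Any P xs ⊎ All Q xs
anyOrAll []              = inj₂ []
anyOrAll (inj₁ p ∷ pqs)  = inj₁ (here p)
anyOrAll (inj₂ q ∷ pqs)  = Sum.map there (q ∷_) (anyOrAll pqs)

module _ {c : ℕ} where

  minEH-lower : ∀ {n} (t : Tree c) (ts : List (Tree c)) →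
                n ≤ minEH t ts → All (λ u → n ≤ effHeight u) (t ∷ ts)
  minEH-lower t []       h = h ∷ []
  minEH-lower t (u ∷ us) h =
    ≤-trans h (m⊓n≤m _ _) ∷ minEH-lower u us (≤-trans h (m⊓n≤n _ _))

  minEH-glb : ∀ {n} (t : Tree c) (ts : List (Tree c)) →
              All (λ u → n ≤ effHeight u) (t ∷ ts) → n ≤ minEH t ts
  minEH-glb t []       (h ∷ []) = h
  minEH-glb t (u ∷ us) (h ∷ hs) = ⊓-glb h (minEH-glb u us hs)

  []⊑ : (ts : List (Tree c)) → [] ⊑ ts
  []⊑ []       = []
  []⊑ (t ∷ ts) = skip ([]⊑ ts)

  ∈⇒⊑ : ∀ {s t} {ts : List (Tree c)} → t ∈ ts → s ≼ t → (s ∷ []) ⊑ ts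
  ∈⇒⊑ {ts = _ ∷ ts} (here refl) s≼t = keep s≼t ([]⊑ ts)
  ∈⇒⊑               (there t∈)  s≼t = skip (∈⇒⊑ t∈ s≼t)

module _ {c : ℕ} (d : ℕ) where

  Rooted : Fin c → ℕ → Tree c → Set
  Rooted i k t = Σ (Tree c) λ S → S ≼ t × IsDBranch d S × EssMono i S × k ≤ effHeight S

  Witness : Vec ℕ c → Tree c → Set
  Witness v t = Σ (Fin c) λ i → Rooted i (lookup v i) t

  root-only : ∀ {x k ts} → k ≤ 0 → Rooted x k (node x ts)
  root-only {ts = ts} k≤0 = node _ [] , node ([]⊑ ts) , ((λ ()) , tt) , refl , k≤0

  -- A tree found below a child is hung under the root, which then has a single
  -- child and so is not an effective vertex.
  descend : ∀ {x i k t ts} → t ∈ ts → Rooted i k t → Rooted i k (node x ts)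
  descend t∈ts (S , S≼t , dS , mS , hS) =
    node _ (S ∷ []) , node (∈⇒⊑ t∈ts S≼t) , ((λ { (s≤s ()) }) , dS , tt) , mS , hS

  collect : ∀ {x k} {ts : List (Tree c)} → All (Rooted x k) ts →
            Σ (List (Tree c)) λ ss → ss ⊑ ts × length ss ≡ length ts ×
              AllDBranch d ss × AllEssMono x ss × All (λ s → k ≤ effHeight s) ss
  collect []                           = [] , [] , refl , tt , tt , []
  collect ((S , S≼t , dS , mS , hS) ∷ rs) =
    let ss , ss⊑ts , len , dss , mss , hss = collect rs
    in S ∷ ss , keep S≼t ss⊑ts , cong suc len , (dS , dss) , (mS , mss) , hS ∷ hss

  graft : ∀ {x k t u us} →
          (2 ≤ length (t ∷ u ∷ us) → d ≤ length (t ∷ u ∷ us)) →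
          All (Rooted x k) (t ∷ u ∷ us) → Rooted x (suc k) (node x (t ∷ u ∷ us))
  graft branching ((S , S≼t , dS , mS , hS) ∷ (S′ , S′≼u , dS′ , mS′ , hS′) ∷ rs) =
    let ss , ss⊑us , len , dss , mss , hss = collect rs
    in node _ (S ∷ S′ ∷ ss) ,
       node (keep S≼t (keep S′≼u ss⊑us)) ,
       ((λ _ → subst (λ m → d ≤ suc (suc m)) (sym len) (branching (s≤s (s≤s z≤n))))
          , dS , dS′ , dss) ,
       (refl , mS , mS′ , mss) ,
       s≤s (minEH-glb S (S′ ∷ ss) (hS ∷ hS′ ∷ hss))

  -- A child's witness for the lowered budget is either a witness for the
  -- original budget (its colour i ≠ x keeps budget vᵢ), or an x-coloured tree
  -- of height ≥ vₓ − 1.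
  classify : ∀ {v : Vec ℕ c} {x : Fin c} {k t} → lookup v x ≡ suc k →
             Witness (lower v x) t → Witness v t ⊎ Rooted x k t
  classify {v} {x} eq (i , S , S≼t , dS , mS , hS) with i ≟ x
  ... | no i≢x = inj₁ (i , S , S≼t , dS , mS ,
                       subst (_≤ effHeight S) (lookup∘updateAt′ i x i≢x v) hS)
  ... | yes refl = inj₂ (S , S≼t , dS , mS ,
                         subst (_≤ effHeight S) (trans (lookup∘updateAt x v) (cong pred eq)) hS)

  branch-step : ∀ {v : Vec ℕ c} {x : Fin c} {k} {t u us} → lookup v x ≡ suc k →
                (2 ≤ length (t ∷ u ∷ us) → d ≤ length (t ∷ u ∷ us)) →
                All (Witness (lower v x)) (t ∷ u ∷ us) → Witness v (node x (t ∷ u ∷ us))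
  branch-step {v} {x} eq branching ws with anyOrAll (All.map (classify {v} {x} eq) ws)
  ... | inj₁ some = let _ , t∈ts , i , r = find some in i , descend t∈ts r
  ... | inj₂ all  = x , subst (λ m → Rooted x m _) (sym eq) (graft branching all)

  children-bound : ∀ {v : Vec ℕ c} {x : Fin c} {k} {t u us} → lookup v x ≡ suc k →
                   sum v ≤ effHeight (node x (t ∷ u ∷ us)) →
                   All (λ w → sum (lower v x) ≤ effHeight w) (t ∷ u ∷ us)
  children-bound {v} {x} {t = t} {u} {us} eq h =
    minEH-lower t (u ∷ us) (s≤s⁻¹ (subst (_≤ _) (sum-lower v x eq) h))

  by-budget : ∀ {ts} (v : Vec ℕ c) (x : Fin c) →
              (∀ {k} → lookup v x ≡ suc k → Witness v (node x ts)) → Witness v (node x ts)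
  by-budget {ts} v x positive = cases (lookup v x) refl
    where
      cases : (n : ℕ) → lookup v x ≡ n → Witness v (node x ts)
      cases zero    eq = x , root-only (≤-reflexive eq)
      cases (suc k) eq = positive eq

  mutual
    witness : (v : Vec ℕ c) (T : Tree c) → IsDBranch d T → sum v ≤ effHeight T → Witness v T
    witness v (node x [])            _              h = x , root-only (≤-trans (lookup≤sum v x) h)
    witness v (node x (t ∷ []))      (_ , dt , _)   h =
      let i , r = witness v t dt h in i , descend (here refl) r
    witness v (node x (t ∷ u ∷ us)) (branching , dts) h = by-budget v x λ eq →
      branch-step {v} {x} eq branching
        (witnesses (lower v x) (t ∷ u ∷ us) dts (children-bound {v} {x} eq h))

    witnesses : (v : Vec ℕ c) (ts : List (Tree c)) → AllDBranch d ts →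
                All (λ t → sum v ≤ effHeight t) ts → All (Witness v) ts
    witnesses v []       _          []       = []
    witnesses v (t ∷ ts) (dt , dts) (h ∷ hs) = witness v t dt h ∷ witnesses v ts dts hs

-- The theorem: take the budget vector (a₁,…,a_c) and forget that the
-- embedding is at the root.
lemma11 : (c d : ℕ) → 1 ≤ c → 2 ≤ d → (a : Fin c → ℕ) →
    (T : Tree c) → IsDBranch d T → sum (tabulate a) ≤ effHeight T →
    Σ (Fin c) λ i → Σ (Tree c) λ S →
    S ⊆ᵀ T × IsDBranch d S × EssMono i S × a i ≤ effHeight S
lemma11 c d _ _ a T dT h =
  let i , S , S≼T , dS , mS , hS = witness d (tabulate a) T dT h
  in i , S , here S≼T , dS , mS , subst (_≤ effHeight S) (lookup∘tabulate a i) hS
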